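{- Let $n>0$ and $k>3$ be integers. The number of cliques of size $k$ (sets of $k$ pairwise adjacent vertices) in the occurrence graph $G_{12}(\mathrm{id}_n)$ is \[ (k+1)\binom{n}{k+1} = n\binom{n-1}{k}. \]
   Context: $\mathrm{id}_n$ denotes the identity permutation $12\cdots n$. For a permutation $p$ of length $k$ and a permutation $\pi$ of length $n$, an index set of $p$ in $\pi$ is a set $\{i_1<\dots<i_k\}\subseteq\{1,\dots,n\}$ such that $\pi(i_1)\cdots\pi(i_k)$ is order-isomorphic to $p$. The occurrence set $V_p(\pi)$ is the set of all such index sets, and the occurrence graph $G_p(\pi)$ is the simple undirected graph with vertex set $V_p(\pi)$ in which $u,v$ are adjacent iff $|u\setminus v|=|v\setminus u|=1$. Thus $G_{12}(\mathrm{id}_n)$ has as vertices all 2-element subsets of $\{1,\dots,n\}$, two being adjacent iff they share exactly one element. -}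

module Defs where

open import Data.Bool using (Bool; true; false; _∧_; not)
open import Data.Nat using (ℕ; zero; suc; _≡ᵇ_; _<ᵇ_)
open import Data.List using (List; []; _∷_; [_]; map; _++_; length; filterᵇ; zip; upTo)
open import Data.Bool.ListAction using (all; any)
open import Data.Product using (_×_; _,_; proj₁; proj₂)

_==_ : Bool → Bool → Bool
true  == b = b
false == b = not b

-- All k-element sublists (in original order) of a list: the k-subsets of its
-- entries, each listed once when the entries are distinct.
combinations : {A : Set} → ℕ → List A → List (List A)
combinations zero    _        = [ [] ]
combinations (suc k) []       = []
combinations (suc k) (x ∷ xs) = map (x ∷_) (combinations k xs) ++ combinations (suc k) xs

orderIsoᵇ : List ℕ → List ℕ → Bool
orderIsoᵇ []       []       = true
orderIsoᵇ []       (_ ∷ _)  = false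
orderIsoᵇ (_ ∷ _)  []       = false
orderIsoᵇ (x ∷ xs) (y ∷ ys) =
  all (λ ab → ((x <ᵇ proj₁ ab) == (y <ᵇ proj₂ ab)) ∧ ((proj₁ ab <ᵇ x) == (proj₂ ab <ᵇ y)))
      (zip xs ys)
  ∧ orderIsoᵇ xs ys

-- A permutation of length n is given as the list π(1) ... π(n) (positions are
-- 0-based here). An index set is an increasing list of positions.
IndexSet : Set
IndexSet = List ℕ

occurrences : List ℕ → List ℕ → List IndexSet
occurrences p π =
  map (map proj₁)
    (filterᵇ (λ s → orderIsoᵇ (map proj₂ s) p)
      (combinations (length p) (zip (upTo (length π)) π)))

memᵇ : ℕ → List ℕ → Bool
memᵇ i v = any (i ≡ᵇ_) v

diffSize : IndexSet → IndexSet → ℕ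
diffSize u v = length (filterᵇ (λ i → not (memᵇ i v)) u)

adjacentᵇ : IndexSet → IndexSet → Bool
adjacentᵇ u v = (diffSize u v ≡ᵇ 1) ∧ (diffSize v u ≡ᵇ 1)

pairwiseAdjᵇ : List IndexSet → Bool
pairwiseAdjᵇ []       = true
pairwiseAdjᵇ (u ∷ us) = all (adjacentᵇ u) us ∧ pairwiseAdjᵇ us

numCliques : ℕ → List ℕ → List ℕ → ℕ
numCliques k p π = length (filterᵇ pairwiseAdjᵇ (combinations k (occurrences p π)))

idPerm : ℕ → List ℕ
idPerm n = map suc (upTo n)

pat12 : List ℕ
pat12 = 1 ∷ 2 ∷ []

module Submission where

-- Occurrences of 12 in id_n are exactly the index sets {i < j}, so the graph is
-- the line graph of K_n: its vertices are the 2-subsets of {0,…,n-1}, two pairs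
-- being adjacent iff they share one point.  A clique of ≥ 4 such pairs is a star: all its pairs
-- pass through one common point, hence there are n·C(n-1,k) of them.
--
-- The pairs of {0,…,n} split into the pairs
-- {0, j+1} through the new point 0 and the shifted pairs of {0,…,n-1}
-- ('pairs-suc').  Removing the vertices {0, j+1} one at a time ('cliques-cons'),
-- the neighbourhood of {0, d+1} consists of the remaining {0, j+1} (a clique)
-- and the shifted star at d (a clique of size n-1), the cross edges forming a
-- partial matching; such a graph has no clique of size ≥ 3 meeting both parts
-- ('cliques-matching'), which is where k ≥ 4 is used.  This gives the recurrence of 'cliques-pairs'; the
-- absorption identity (k+1)·C(n,k+1) = n·C(n-1,k) finishes the proof.

open import Defs
open import Data.Bool using (Bool; true; false; _∧_; _∨_; not; T)
open import Data.Bool.ListAction using (all; and)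
open import Data.Bool.Properties using (∨-identityʳ)
open import Data.Empty using (⊥; ⊥-elim)
open import Data.Nat using (ℕ; zero; suc; _+_; _*_; _∸_; _<_; _≤_; _≡ᵇ_; s≤s; z≤n)
open import Data.Nat.Properties
open import Data.Nat.Combinatorics using (_C_; nCk+nC[k+1]≡[n+1]C[k+1])
open import Data.Nat.Solver using (module +-*-Solver)
open import Data.List using (List; []; _∷_; [_]; map; _++_; length; filterᵇ; zip; upTo)
open import Data.List.Properties
  using (length-map; length-++; ++-identityʳ; map-++; map-∘; map-id; map-cong; length-upTo; map-upTo; filter-++)
open import Data.List.Relation.Unary.All as All using (All; []; _∷_; universal)
open import Data.List.Relation.Unary.All.Properties using (all-upTo) renaming (map⁺ to All-map⁺; ++⁺ to All-++⁺; filter⁺ to All-filter⁺)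
open import Data.List.Relation.Unary.AllPairs using (AllPairs; []; _∷_)
open import Data.List.Relation.Unary.AllPairs.Properties using (applyUpTo⁺₁) renaming (map⁺ to AllPairs-map⁺)
open import Data.Product using (_×_; _,_; proj₁; proj₂; Σ-syntax)
open import Data.Sum using (_⊎_; inj₁; inj₂)
open import Function using (_∘_)
open import Relation.Nullary using (yes; no)
open import Relation.Nullary.Decidable using (T?; dec-true; dec-false)
open import Relation.Binary.PropositionalEquality hiding ([_])

variable
  A B : Set

≡ᵇ-refl : (d : ℕ) → (d ≡ᵇ d) ≡ true
≡ᵇ-refl d = dec-true (d ≟ d) refl

≢⇒≡ᵇ-false : {d e : ℕ} → d ≢ e → (d ≡ᵇ e) ≡ false
≢⇒≡ᵇ-false {d} {e} = dec-false (d ≟ e)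

≡ᵇ-true⇒≡ : {d e : ℕ} → (d ≡ᵇ e) ≡ true → d ≡ e
≡ᵇ-true⇒≡ {d} {e} eq = ≡ᵇ⇒≡ d e (subst T (sym eq) _)

∧-true : {a b : Bool} → a ∧ b ≡ true → a ≡ true × b ≡ true
∧-true {true} eq = refl , eq

filterᵇ-++ : (p : A → Bool) (xs ys : List A) → filterᵇ p (xs ++ ys) ≡ filterᵇ p xs ++ filterᵇ p ys
filterᵇ-++ p = filter-++ (T? ∘ p)

length-filterᵇ-++ : (p : A → Bool) (xs ys : List A) →
  length (filterᵇ p (xs ++ ys)) ≡ length (filterᵇ p xs) + length (filterᵇ p ys)
length-filterᵇ-++ p xs ys = trans (cong length (filterᵇ-++ p xs ys)) (length-++ (filterᵇ p xs))

filterᵇ-map : (p : B → Bool) (f : A → B) (xs : List A) → filterᵇ p (map f xs) ≡ map f (filterᵇ (p ∘ f) xs)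
filterᵇ-map p f [] = refl
filterᵇ-map p f (x ∷ xs) with p (f x)
... | true  = cong (f x ∷_) (filterᵇ-map p f xs)
... | false = filterᵇ-map p f xs

length-filterᵇ-map : (p : B → Bool) (f : A → B) (xs : List A) →
  length (filterᵇ p (map f xs)) ≡ length (filterᵇ (p ∘ f) xs)
length-filterᵇ-map p f xs = trans (cong length (filterᵇ-map p f xs)) (length-map f (filterᵇ (p ∘ f) xs))

filterᵇ-cong : {p q : A → Bool} (xs : List A) → All (λ x → p x ≡ q x) xs → filterᵇ p xs ≡ filterᵇ q xs
filterᵇ-cong [] [] = refl
filterᵇ-cong {q = q} (x ∷ xs) (px≡qx ∷ eqs) rewrite px≡qx with q x
... | true  = cong (x ∷_) (filterᵇ-cong xs eqs)
... | false = filterᵇ-cong xs eqs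

filterᵇ-all : (p : A → Bool) (xs : List A) → All (λ x → p x ≡ true) xs → filterᵇ p xs ≡ xs
filterᵇ-all p [] [] = refl
filterᵇ-all p (x ∷ xs) (px ∷ pxs) rewrite px = cong (x ∷_) (filterᵇ-all p xs pxs)

filterᵇ-none : (p : A → Bool) (xs : List A) → All (λ x → p x ≡ false) xs → filterᵇ p xs ≡ []
filterᵇ-none p [] [] = refl
filterᵇ-none p (x ∷ xs) (px ∷ pxs) rewrite px = filterᵇ-none p xs pxs

filterᵇ-satisfies : (p : A → Bool) (xs : List A) → All (λ x → p x ≡ true) (filterᵇ p xs)
filterᵇ-satisfies p [] = []
filterᵇ-satisfies p (x ∷ xs) with p x in px
... | true  = px ∷ filterᵇ-satisfies p xs
... | false = filterᵇ-satisfies p xs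

all-true : (p : A → Bool) (xs : List A) → All (λ x → p x ≡ true) xs → all p xs ≡ true
all-true p [] [] = refl
all-true p (x ∷ xs) (px ∷ pxs) rewrite px = all-true p xs pxs

true-all : (p : A → Bool) (xs : List A) → all p xs ≡ true → All (λ x → p x ≡ true) xs
true-all p [] _ = []
true-all p (x ∷ xs) eq = proj₁ (∧-true eq) ∷ true-all p xs (proj₂ (∧-true eq))

all-cong : {p q : A → Bool} (xs : List A) → All (λ x → p x ≡ q x) xs → all p xs ≡ all q xs
all-cong [] [] = refl
all-cong (x ∷ xs) (e ∷ es) = cong₂ _∧_ e (all-cong xs es)

all-map : (p : B → Bool) (f : A → B) (xs : List A) → all p (map f xs) ≡ all (p ∘ f) xs
all-map p f xs = cong and (sym (map-∘ xs))

allPairs-combine : {P : A → Set} {R S : A → A → Set} →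
  (∀ {x y} → P x → P y → R x y → S x y) → {xs : List A} → All P xs → AllPairs R xs → AllPairs S xs
allPairs-combine f [] [] = []
allPairs-combine f (px ∷ pxs) (rx ∷ rxs) =
  All.zipWith (λ (py , r) → f px py r) (pxs , rx) ∷ allPairs-combine f pxs rxs

cliques : ℕ → List IndexSet → ℕ
cliques k L = length (filterᵇ pairwiseAdjᵇ (combinations k L))

count-combinations-cons : (Q : List A → Bool) (x : A) (k : ℕ) (L : List A) →
  length (filterᵇ Q (combinations (suc k) (x ∷ L)))
    ≡ length (filterᵇ (Q ∘ (x ∷_)) (combinations k L)) + length (filterᵇ Q (combinations (suc k) L))
count-combinations-cons Q x k L =
  trans (length-filterᵇ-++ Q (map (x ∷_) (combinations k L)) _)
        (cong (_+ _) (length-filterᵇ-map Q (x ∷_) (combinations k L)))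

count-combinations-filter : (k : ℕ) (P : A → Bool) (Q : List A → Bool) (L : List A) →
  length (filterᵇ (λ S → all P S ∧ Q S) (combinations k L)) ≡ length (filterᵇ Q (combinations k (filterᵇ P L)))
count-combinations-filter zero P Q L with Q []
... | true  = refl
... | false = refl
count-combinations-filter (suc k) P Q [] = refl
count-combinations-filter (suc k) P Q (x ∷ L) with P x in Px
... | true = begin
  length (filterᵇ PQ (combinations (suc k) (x ∷ L)))
    ≡⟨ count-combinations-cons PQ x k L ⟩
  length (filterᵇ (PQ ∘ (x ∷_)) (combinations k L)) + length (filterᵇ PQ (combinations (suc k) L))
    ≡⟨ cong (λ X → length X + length (filterᵇ PQ (combinations (suc k) L))) (filterᵇ-cong (combinations k L)
         (universal (λ S → cong (λ b → (b ∧ all P S) ∧ Q (x ∷ S)) Px) _)) ⟩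
  length (filterᵇ (λ S → all P S ∧ Q (x ∷ S)) (combinations k L)) + length (filterᵇ PQ (combinations (suc k) L))
    ≡⟨ cong₂ _+_ (count-combinations-filter k P (Q ∘ (x ∷_)) L) (count-combinations-filter (suc k) P Q L) ⟩
  length (filterᵇ (Q ∘ (x ∷_)) (combinations k (filterᵇ P L))) + length (filterᵇ Q (combinations (suc k) (filterᵇ P L)))
    ≡⟨ count-combinations-cons Q x k (filterᵇ P L) ⟨
  length (filterᵇ Q (combinations (suc k) (x ∷ filterᵇ P L))) ∎
  where
  open ≡-Reasoning
  PQ = λ S → all P S ∧ Q S
... | false = begin
  length (filterᵇ PQ (combinations (suc k) (x ∷ L)))
    ≡⟨ count-combinations-cons PQ x k L ⟩
  length (filterᵇ (PQ ∘ (x ∷_)) (combinations k L)) + length (filterᵇ PQ (combinations (suc k) L))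
    ≡⟨ cong (λ X → length X + length (filterᵇ PQ (combinations (suc k) L))) (filterᵇ-none _ (combinations k L)
         (universal (λ S → cong (λ b → (b ∧ all P S) ∧ Q (x ∷ S)) Px) _)) ⟩
  length (filterᵇ PQ (combinations (suc k) L))
    ≡⟨ count-combinations-filter (suc k) P Q L ⟩
  length (filterᵇ Q (combinations (suc k) (filterᵇ P L))) ∎
  where
  open ≡-Reasoning
  PQ = λ S → all P S ∧ Q S

cliques-cons : (k : ℕ) (x : IndexSet) (L : List IndexSet) →
  cliques (suc k) (x ∷ L) ≡ cliques k (filterᵇ (adjacentᵇ x) L) + cliques (suc k) L
cliques-cons k x L =
  trans (count-combinations-cons pairwiseAdjᵇ x k L)
        (cong (_+ cliques (suc k) L) (count-combinations-filter k (adjacentᵇ x) pairwiseAdjᵇ L))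

cliques-complete : (k : ℕ) (L : List IndexSet) → pairwiseAdjᵇ L ≡ true → cliques k L ≡ length L C k
cliques-complete zero L _ = refl
cliques-complete (suc k) [] _ = refl
cliques-complete (suc k) (x ∷ L) pw = begin
  cliques (suc k) (x ∷ L)                                 ≡⟨ cliques-cons k x L ⟩
  cliques k (filterᵇ (adjacentᵇ x) L) + cliques (suc k) L
    ≡⟨ cong (λ X → cliques k X + cliques (suc k) L) (filterᵇ-all _ L (true-all _ L (proj₁ (∧-true pw)))) ⟩
  cliques k L + cliques (suc k) L
    ≡⟨ cong₂ _+_ (cliques-complete k L pwL) (cliques-complete (suc k) L pwL) ⟩
  length L C k + length L C suc k                         ≡⟨ nCk+nC[k+1]≡[n+1]C[k+1] (length L) k ⟩
  suc (length L) C suc k                                  ∎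
  where
  open ≡-Reasoning
  pwL = proj₂ (∧-true pw)

cliques-disjoint-++ : (k : ℕ) (X Y : List IndexSet) → All (λ x → filterᵇ (adjacentᵇ x) Y ≡ []) X →
  cliques (suc k) (X ++ Y) ≡ cliques (suc k) X + cliques (suc k) Y
cliques-disjoint-++ k [] Y [] = refl
cliques-disjoint-++ k (x ∷ X) Y (noEdge ∷ noEdges) = begin
  cliques (suc k) (x ∷ X ++ Y)                                          ≡⟨ cliques-cons k x (X ++ Y) ⟩
  cliques k (filterᵇ (adjacentᵇ x) (X ++ Y)) + cliques (suc k) (X ++ Y)
    ≡⟨ cong₂ _+_ (cong (cliques k) neighboursInX) (cliques-disjoint-++ k X Y noEdges) ⟩
  cliques k (filterᵇ (adjacentᵇ x) X) + (cliques (suc k) X + cliques (suc k) Y)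
    ≡⟨ +-assoc (cliques k (filterᵇ (adjacentᵇ x) X)) _ _ ⟨
  (cliques k (filterᵇ (adjacentᵇ x) X) + cliques (suc k) X) + cliques (suc k) Y
    ≡⟨ cong (_+ cliques (suc k) Y) (cliques-cons k x X) ⟨
  cliques (suc k) (x ∷ X) + cliques (suc k) Y                           ∎
  where
  open ≡-Reasoning
  neighboursInX : filterᵇ (adjacentᵇ x) (X ++ Y) ≡ filterᵇ (adjacentᵇ x) X
  neighboursInX = trans (filterᵇ-++ (adjacentᵇ x) X Y)
                        (trans (cong (filterᵇ (adjacentᵇ x) X ++_) noEdge) (++-identityʳ _))

cliques-≤1 : (m : ℕ) (W : List IndexSet) → length W ≤ 1 → cliques (2 + m) W ≡ 0
cliques-≤1 m [] _ = refl
cliques-≤1 m (w ∷ []) _ = refl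
cliques-≤1 m (w ∷ v ∷ W) (s≤s ())

-- Two cliques X, Y whose cross edges form a partial matching (each x ∈ X has at most
-- one neighbour in Y, and no vertex of Y is adjacent to two vertices of X) have no
-- mixed cliques of size ≥ 3.
cliques-matching : (m : ℕ) (X Y : List IndexSet) → pairwiseAdjᵇ X ≡ true → pairwiseAdjᵇ Y ≡ true →
  All (λ x → length (filterᵇ (adjacentᵇ x) Y) ≤ 1) X →
  AllPairs (λ x x′ → filterᵇ (adjacentᵇ x′) (filterᵇ (adjacentᵇ x) Y) ≡ []) X →
  cliques (3 + m) (X ++ Y) ≡ length X C (3 + m) + length Y C (3 + m)
cliques-matching m [] Y _ pwY [] [] = cliques-complete (3 + m) Y pwY
cliques-matching m (x ∷ X) Y pw pwY (fewNbrs ∷ fewNbrss) (noCommon ∷ noCommons) = begin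
  cliques (3 + m) (x ∷ X ++ Y)                                               ≡⟨ cliques-cons (2 + m) x (X ++ Y) ⟩
  cliques (2 + m) (filterᵇ (adjacentᵇ x) (X ++ Y)) + cliques (3 + m) (X ++ Y)
    ≡⟨ cong₂ _+_ (cong (cliques (2 + m)) neighbours) (cliques-matching m X Y pwX pwY fewNbrss noCommons) ⟩
  cliques (2 + m) (X ++ N) + rest
    ≡⟨ cong (_+ rest) (cliques-disjoint-++ (1 + m) X N noCommon) ⟩
  (cliques (2 + m) X + cliques (2 + m) N) + rest
    ≡⟨ cong (_+ rest) (cong₂ _+_ (cliques-complete (2 + m) X pwX) (cliques-≤1 m N fewNbrs)) ⟩
  (length X C (2 + m) + 0) + rest
    ≡⟨ cong (_+ rest) (+-identityʳ (length X C (2 + m))) ⟩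
  length X C (2 + m) + (length X C (3 + m) + length Y C (3 + m))
    ≡⟨ +-assoc (length X C (2 + m)) (length X C (3 + m)) (length Y C (3 + m)) ⟨
  (length X C (2 + m) + length X C (3 + m)) + length Y C (3 + m)
    ≡⟨ cong (_+ length Y C (3 + m)) (nCk+nC[k+1]≡[n+1]C[k+1] (length X) (2 + m)) ⟩
  suc (length X) C (3 + m) + length Y C (3 + m)                               ∎
  where
  open ≡-Reasoning
  N = filterᵇ (adjacentᵇ x) Y
  rest = length X C (3 + m) + length Y C (3 + m)
  pwX = proj₂ (∧-true pw)
  neighbours : filterᵇ (adjacentᵇ x) (X ++ Y) ≡ X ++ N
  neighbours = trans (filterᵇ-++ (adjacentᵇ x) X Y)
                     (cong (_++ N) (filterᵇ-all _ X (true-all _ X (proj₁ (∧-true pw)))))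

pairwiseAdj-++ : (X Y : List IndexSet) → pairwiseAdjᵇ X ≡ true → pairwiseAdjᵇ Y ≡ true →
  All (λ x → all (adjacentᵇ x) Y ≡ true) X → pairwiseAdjᵇ (X ++ Y) ≡ true
pairwiseAdj-++ [] Y _ pwY [] = pwY
pairwiseAdj-++ (x ∷ X) Y pw pwY (joined ∷ joineds) =
  cong₂ _∧_ (all-true _ (X ++ Y) (All-++⁺ (true-all _ X (proj₁ (∧-true pw))) (true-all _ Y joined)))
            (pairwiseAdj-++ X Y (proj₂ (∧-true pw)) pwY joineds)

pairwiseAdj-≤1 : (X : List IndexSet) → length X ≤ 1 → pairwiseAdjᵇ X ≡ true
pairwiseAdj-≤1 [] _ = refl
pairwiseAdj-≤1 (x ∷ []) _ = refl
pairwiseAdj-≤1 (x ∷ y ∷ X) (s≤s ())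

shift : List IndexSet → List IndexSet
shift = map (map suc)

memᵇ-suc : (i : ℕ) (v : List ℕ) → memᵇ (suc i) (map suc v) ≡ memᵇ i v
memᵇ-suc i [] = refl
memᵇ-suc i (x ∷ v) = cong ((i ≡ᵇ x) ∨_) (memᵇ-suc i v)

memᵇ-zero-suc : (v : List ℕ) → memᵇ 0 (map suc v) ≡ false
memᵇ-zero-suc [] = refl
memᵇ-zero-suc (x ∷ v) = memᵇ-zero-suc v

diffSize-suc : (u v : IndexSet) → diffSize (map suc u) (map suc v) ≡ diffSize u v
diffSize-suc u v = trans (length-filterᵇ-map (λ i → not (memᵇ i (map suc v))) suc u)
                         (cong length (filterᵇ-cong u (universal (λ i → cong not (memᵇ-suc i v)) u)))

adjacent-suc : (u v : IndexSet) → adjacentᵇ (map suc u) (map suc v) ≡ adjacentᵇ u v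
adjacent-suc u v = cong₂ (λ a b → (a ≡ᵇ 1) ∧ (b ≡ᵇ 1)) (diffSize-suc u v) (diffSize-suc v u)

pairwiseAdj-shift : (S : List IndexSet) → pairwiseAdjᵇ (shift S) ≡ pairwiseAdjᵇ S
pairwiseAdj-shift [] = refl
pairwiseAdj-shift (u ∷ S) =
  cong₂ _∧_ (trans (all-map (adjacentᵇ (map suc u)) (map suc) S) (all-cong S (universal (adjacent-suc u) S)))
            (pairwiseAdj-shift S)

combinations-map : (f : A → B) (k : ℕ) (L : List A) → combinations k (map f L) ≡ map (map f) (combinations k L)
combinations-map f zero L = refl
combinations-map f (suc k) [] = refl
combinations-map f (suc k) (x ∷ L) = begin
  map (f x ∷_) (combinations k (map f L)) ++ combinations (suc k) (map f L)
    ≡⟨ cong₂ _++_ (cong (map (f x ∷_)) (combinations-map f k L)) (combinations-map f (suc k) L) ⟩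
  map (f x ∷_) (map (map f) (combinations k L)) ++ map (map f) (combinations (suc k) L)
    ≡⟨ cong (_++ map (map f) (combinations (suc k) L))
         (trans (sym (map-∘ (combinations k L))) (map-∘ (combinations k L))) ⟩
  map (map f) (map (x ∷_) (combinations k L)) ++ map (map f) (combinations (suc k) L)
    ≡⟨ map-++ (map f) (map (x ∷_) (combinations k L)) _ ⟨
  map (map f) (map (x ∷_) (combinations k L) ++ combinations (suc k) L) ∎
  where open ≡-Reasoning

cliques-shift : (k : ℕ) (L : List IndexSet) → cliques k (shift L) ≡ cliques k L
cliques-shift k L = begin
  length (filterᵇ pairwiseAdjᵇ (combinations k (shift L)))
    ≡⟨ cong (length ∘ filterᵇ pairwiseAdjᵇ) (combinations-map (map suc) k L) ⟩
  length (filterᵇ pairwiseAdjᵇ (map shift (combinations k L)))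
    ≡⟨ length-filterᵇ-map pairwiseAdjᵇ shift (combinations k L) ⟩
  length (filterᵇ (pairwiseAdjᵇ ∘ shift) (combinations k L))
    ≡⟨ cong length (filterᵇ-cong (combinations k L) (universal pairwiseAdj-shift _)) ⟩
  cliques k L ∎
  where open ≡-Reasoning

pairs : ℕ → List IndexSet
pairs n = combinations 2 (upTo n)

pair₀ : ℕ → IndexSet
pair₀ j = 0 ∷ suc j ∷ []

IsPair : IndexSet → Set
IsPair v = Σ[ i ∈ ℕ ] Σ[ j ∈ ℕ ] i < j × v ≡ i ∷ j ∷ []

upTo-suc : (n : ℕ) → upTo (suc n) ≡ 0 ∷ map suc (upTo n)
upTo-suc n = cong (0 ∷_) (sym (map-upTo suc n))

upTo-distinct : (n : ℕ) → AllPairs _≢_ (upTo n)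
upTo-distinct n = applyUpTo⁺₁ (λ i → i) n (λ i<j _ → <⇒≢ i<j)

pairs-suc : (n : ℕ) → pairs (suc n) ≡ map pair₀ (upTo n) ++ shift (pairs n)
pairs-suc n = begin
  combinations 2 (upTo (suc n))
    ≡⟨ cong (combinations 2) (upTo-suc n) ⟩
  map (0 ∷_) (combinations 1 (map suc (upTo n))) ++ combinations 2 (map suc (upTo n))
    ≡⟨ cong₂ _++_ (cong (map (0 ∷_)) (singletons (map suc (upTo n)))) (combinations-map suc 2 (upTo n)) ⟩
  map (0 ∷_) (map [_] (map suc (upTo n))) ++ shift (pairs n)
    ≡⟨ cong (_++ shift (pairs n)) (trans (sym (map-∘ (map suc (upTo n)))) (sym (map-∘ (upTo n)))) ⟩
  map pair₀ (upTo n) ++ shift (pairs n) ∎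
  where
  open ≡-Reasoning
  singletons : (L : List ℕ) → combinations 1 L ≡ map [_] L
  singletons [] = refl
  singletons (x ∷ L) = cong ([ x ] ∷_) (singletons L)

pairs-are-pairs : (n : ℕ) → All IsPair (pairs n)
pairs-are-pairs zero = []
pairs-are-pairs (suc n) = subst (All IsPair) (sym (pairs-suc n))
  (All-++⁺ (All-map⁺ (universal (λ j → 0 , suc j , s≤s z≤n , refl) (upTo n)))
           (All-map⁺ (All.map (λ { (i , j , i<j , refl) → suc i , suc j , s≤s i<j , refl }) (pairs-are-pairs n))))

indicator : Bool → ℕ
indicator true  = 1
indicator false = 0

length-filterᵇ-pair : (p : A → Bool) (a b : A) → length (filterᵇ p (a ∷ b ∷ [])) ≡ indicator (p a) + indicator (p b)
length-filterᵇ-pair p a b with p a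
... | true with p b
...   | true  = refl
...   | false = refl
length-filterᵇ-pair p a b | false with p b
...   | true  = refl
...   | false = refl

adjacent-pairs : (a b c e : ℕ) → adjacentᵇ (a ∷ b ∷ []) (c ∷ e ∷ []) ≡
  ((indicator (not (memᵇ a (c ∷ e ∷ []))) + indicator (not (memᵇ b (c ∷ e ∷ []))) ≡ᵇ 1)
   ∧ (indicator (not (memᵇ c (a ∷ b ∷ []))) + indicator (not (memᵇ e (a ∷ b ∷ []))) ≡ᵇ 1))
adjacent-pairs a b c e =
  cong₂ (λ x y → (x ≡ᵇ 1) ∧ (y ≡ᵇ 1))
        (length-filterᵇ-pair (λ i → not (memᵇ i (c ∷ e ∷ []))) a b)
        (length-filterᵇ-pair (λ i → not (memᵇ i (a ∷ b ∷ []))) c e)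

adjacent-pair₀-shift : (d i j : ℕ) → i < j → adjacentᵇ (pair₀ d) (map suc (i ∷ j ∷ [])) ≡ memᵇ d (i ∷ j ∷ [])
adjacent-pair₀-shift d i j i<j rewrite adjacent-pairs 0 (suc d) (suc i) (suc j) with d ≟ i | d ≟ j
... | yes refl | yes refl = ⊥-elim (<-irrefl refl i<j)
... | yes refl | no d≢j rewrite ≢⇒≡ᵇ-false d≢j | ≢⇒≡ᵇ-false (≢-sym d≢j) | ≡ᵇ-refl d = refl
... | no d≢i | yes refl rewrite ≢⇒≡ᵇ-false d≢i | ≢⇒≡ᵇ-false (≢-sym d≢i) | ≡ᵇ-refl d = refl
... | no d≢i | no d≢j rewrite ≢⇒≡ᵇ-false d≢i | ≢⇒≡ᵇ-false (≢-sym d≢i) | ≢⇒≡ᵇ-false d≢j = refl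

adjacent-pair₀-pair₀ : {e f : ℕ} → e ≢ f → adjacentᵇ (pair₀ e) (pair₀ f) ≡ true
adjacent-pair₀-pair₀ e≢f rewrite ≢⇒≡ᵇ-false e≢f | ≢⇒≡ᵇ-false (≢-sym e≢f) = refl

pairwiseAdj-pair₀ : (D : List ℕ) → AllPairs _≢_ D → pairwiseAdjᵇ (map pair₀ D) ≡ true
pairwiseAdj-pair₀ [] [] = refl
pairwiseAdj-pair₀ (e ∷ D) (e∉D ∷ distinct) =
  cong₂ _∧_ (all-true _ (map pair₀ D) (All-map⁺ (All.map adjacent-pair₀-pair₀ e∉D))) (pairwiseAdj-pair₀ D distinct)

star : ℕ → List IndexSet → List IndexSet
star d = filterᵇ (memᵇ d)

star-are-pairs : (d : ℕ) (L : List IndexSet) → All IsPair L → All IsPair (star d L)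
star-are-pairs d L = All-filter⁺ (T? ∘ memᵇ d)

neighbours-pair₀-shift : (d : ℕ) (L : List IndexSet) → All IsPair L →
  filterᵇ (adjacentᵇ (pair₀ d)) (shift L) ≡ shift (star d L)
neighbours-pair₀-shift d L areP = trans (filterᵇ-map _ (map suc) L) (cong shift (filterᵇ-cong L
  (All.map (λ { (i , j , i<j , refl) → adjacent-pair₀-shift d i j i<j }) areP)))

pair₀-joined-to-star : (d : ℕ) (L : List IndexSet) → All IsPair L →
  all (adjacentᵇ (pair₀ d)) (shift (star d L)) ≡ true
pair₀-joined-to-star d L areP = begin
  all (adjacentᵇ (pair₀ d)) (shift (star d L))   ≡⟨ all-map _ (map suc) (star d L) ⟩
  all (adjacentᵇ (pair₀ d) ∘ map suc) (star d L)
    ≡⟨ all-cong (star d L) (All.map (λ { (i , j , i<j , refl) → adjacent-pair₀-shift d i j i<j })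
                                    (star-are-pairs d L areP)) ⟩
  all (memᵇ d) (star d L)                         ≡⟨ all-true _ (star d L) (filterᵇ-satisfies (memᵇ d) L) ⟩
  true                                            ∎
  where open ≡-Reasoning

neighbours-in-layer : (d : ℕ) (D : List ℕ) (L : List IndexSet) → All (d ≢_) D → All IsPair L →
  filterᵇ (adjacentᵇ (pair₀ d)) (map pair₀ D ++ shift L) ≡ map pair₀ D ++ shift (star d L)
neighbours-in-layer d D L d∉D areP =
  trans (filterᵇ-++ (adjacentᵇ (pair₀ d)) (map pair₀ D) (shift L))
        (cong₂ _++_ (filterᵇ-all _ (map pair₀ D) (All-map⁺ (All.map adjacent-pair₀-pair₀ d∉D)))
                    (neighbours-pair₀-shift d L areP))

star-pair₀-zero : (U : List ℕ) → star 0 (map pair₀ U) ≡ map pair₀ U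
star-pair₀-zero U = filterᵇ-all _ (map pair₀ U) (All-map⁺ (universal (λ _ → refl) U))

star-pair₀-suc : (e : ℕ) (U : List ℕ) → star (suc e) (map pair₀ U) ≡ map pair₀ (filterᵇ (e ≡ᵇ_) U)
star-pair₀-suc e U = trans (filterᵇ-map _ pair₀ U)
  (cong (map pair₀) (filterᵇ-cong U (universal (λ j → ∨-identityʳ (e ≡ᵇ j)) U)))

star-zero-shift : (L : List IndexSet) → star 0 (shift L) ≡ []
star-zero-shift L = filterᵇ-none _ (shift L) (All-map⁺ (universal memᵇ-zero-suc L))

star-suc-shift : (e : ℕ) (L : List IndexSet) → star (suc e) (shift L) ≡ shift (star e L)
star-suc-shift e L = trans (filterᵇ-map _ (map suc) L) (cong shift (filterᵇ-cong L (universal (memᵇ-suc e) L)))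

star-pairs-zero : (n : ℕ) → star 0 (pairs (suc n)) ≡ map pair₀ (upTo n)
star-pairs-zero n = begin
  star 0 (pairs (suc n))                                 ≡⟨ cong (star 0) (pairs-suc n) ⟩
  star 0 (map pair₀ (upTo n) ++ shift (pairs n))         ≡⟨ filterᵇ-++ (memᵇ 0) (map pair₀ (upTo n)) _ ⟩
  star 0 (map pair₀ (upTo n)) ++ star 0 (shift (pairs n))
    ≡⟨ cong₂ _++_ (star-pair₀-zero (upTo n)) (star-zero-shift (pairs n)) ⟩
  map pair₀ (upTo n) ++ []                               ≡⟨ ++-identityʳ _ ⟩
  map pair₀ (upTo n)                                     ∎
  where open ≡-Reasoning

star-pairs-suc : (n d : ℕ) →
  star (suc d) (pairs (suc n)) ≡ map pair₀ (filterᵇ (d ≡ᵇ_) (upTo n)) ++ shift (star d (pairs n))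
star-pairs-suc n d = begin
  star (suc d) (pairs (suc n))                               ≡⟨ cong (star (suc d)) (pairs-suc n) ⟩
  star (suc d) (map pair₀ (upTo n) ++ shift (pairs n))       ≡⟨ filterᵇ-++ (memᵇ (suc d)) (map pair₀ (upTo n)) _ ⟩
  star (suc d) (map pair₀ (upTo n)) ++ star (suc d) (shift (pairs n))
    ≡⟨ cong₂ _++_ (star-pair₀-suc d (upTo n)) (star-suc-shift d (pairs n)) ⟩
  map pair₀ (filterᵇ (d ≡ᵇ_) (upTo n)) ++ shift (star d (pairs n)) ∎
  where open ≡-Reasoning

count-distinct : (d : ℕ) (xs : List ℕ) → AllPairs _≢_ xs → length (filterᵇ (d ≡ᵇ_) xs) ≤ 1
count-distinct d [] [] = z≤n
count-distinct d (x ∷ xs) (x∉xs ∷ distinct) with d ≡ᵇ x in d≡x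
... | true with refl ← ≡ᵇ-true⇒≡ {d} {x} d≡x =
  s≤s (≤-reflexive (cong length (filterᵇ-none _ xs (All.map ≢⇒≡ᵇ-false x∉xs))))
... | false = count-distinct d xs distinct

count-upTo : (n d : ℕ) → d < n → length (filterᵇ (d ≡ᵇ_) (upTo n)) ≡ 1
count-upTo (suc n) zero _ = begin
  length (filterᵇ (0 ≡ᵇ_) (upTo (suc n)))       ≡⟨ cong (length ∘ filterᵇ (0 ≡ᵇ_)) (upTo-suc n) ⟩
  suc (length (filterᵇ (0 ≡ᵇ_) (map suc (upTo n)))) ≡⟨ cong suc (length-filterᵇ-map _ suc (upTo n)) ⟩
  suc (length (filterᵇ (λ _ → false) (upTo n)))  ≡⟨ cong (suc ∘ length) (filterᵇ-none _ (upTo n) (universal (λ _ → refl) _)) ⟩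
  1                                              ∎
  where open ≡-Reasoning
count-upTo (suc n) (suc d) (s≤s d<n) = begin
  length (filterᵇ (suc d ≡ᵇ_) (upTo (suc n)))    ≡⟨ cong (length ∘ filterᵇ (suc d ≡ᵇ_)) (upTo-suc n) ⟩
  length (filterᵇ (suc d ≡ᵇ_) (map suc (upTo n))) ≡⟨ length-filterᵇ-map _ suc (upTo n) ⟩
  length (filterᵇ (d ≡ᵇ_) (upTo n))               ≡⟨ count-upTo n d d<n ⟩
  1                                               ∎
  where open ≡-Reasoning

star-size : (n d : ℕ) → d < n → length (star d (pairs n)) ≡ n ∸ 1
star-size (suc n) zero _ = begin
  length (star 0 (pairs (suc n)))  ≡⟨ cong length (star-pairs-zero n) ⟩
  length (map pair₀ (upTo n))      ≡⟨ length-map pair₀ (upTo n) ⟩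
  length (upTo n)                  ≡⟨ length-upTo n ⟩
  n                                ∎
  where open ≡-Reasoning
star-size (suc n@(suc _)) (suc d) (s≤s d<n) = begin
  length (star (suc d) (pairs (suc n)))           ≡⟨ cong length (star-pairs-suc n d) ⟩
  length (map pair₀ F ++ shift (star d (pairs n)))
    ≡⟨ length-++ (map pair₀ F) ⟩
  length (map pair₀ F) + length (shift (star d (pairs n)))
    ≡⟨ cong₂ _+_ (trans (length-map pair₀ F) (count-upTo n d d<n))
                 (trans (length-map (map suc) (star d (pairs n))) (star-size n d d<n)) ⟩
  n                                               ∎
  where
  open ≡-Reasoning
  F = filterᵇ (d ≡ᵇ_) (upTo n)

-- Each star is a clique: two distinct pairs through d meet exactly in d.
star-clique : (n d : ℕ) → pairwiseAdjᵇ (star d (pairs n)) ≡ true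
star-clique zero d = refl
star-clique (suc n) zero =
  subst (λ X → pairwiseAdjᵇ X ≡ true) (sym (star-pairs-zero n)) (pairwiseAdj-pair₀ (upTo n) (upTo-distinct n))
star-clique (suc n) (suc d) = subst (λ X → pairwiseAdjᵇ X ≡ true) (sym (star-pairs-suc n d))
  (pairwiseAdj-++ (map pair₀ F) (shift S)
    (pairwiseAdj-≤1 (map pair₀ F) (subst (_≤ 1) (sym (length-map pair₀ F)) (count-distinct d (upTo n) (upTo-distinct n))))
    (trans (pairwiseAdj-shift S) (star-clique n d))
    (All-map⁺ (All.map (λ d≡j → subst (λ j → all (adjacentᵇ (pair₀ j)) (shift S) ≡ true) (≡ᵇ-true⇒≡ d≡j)
                                       (pair₀-joined-to-star d (pairs n) (pairs-are-pairs n)))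
                       (filterᵇ-satisfies (d ≡ᵇ_) (upTo n)))))
  where
  F = filterᵇ (d ≡ᵇ_) (upTo n)
  S = star d (pairs n)

star-pair-size : (n d e : ℕ) → d ≢ e → length (star e (star d (pairs n))) ≤ 1
star-pair-size zero d e _ = z≤n
star-pair-size (suc n) zero zero 0≢0 = ⊥-elim (0≢0 refl)
star-pair-size (suc n) zero (suc e) _ = begin
  length (star (suc e) (star 0 (pairs (suc n))))  ≡⟨ cong (length ∘ star (suc e)) (star-pairs-zero n) ⟩
  length (star (suc e) (map pair₀ (upTo n)))      ≡⟨ cong length (star-pair₀-suc e (upTo n)) ⟩
  length (map pair₀ (filterᵇ (e ≡ᵇ_) (upTo n)))   ≡⟨ length-map pair₀ (filterᵇ (e ≡ᵇ_) (upTo n)) ⟩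
  length (filterᵇ (e ≡ᵇ_) (upTo n))               ≤⟨ count-distinct e (upTo n) (upTo-distinct n) ⟩
  1                                               ∎
  where open ≤-Reasoning
star-pair-size (suc n) (suc d) zero _ = begin
  length (star 0 (star (suc d) (pairs (suc n))))  ≡⟨ cong (length ∘ star 0) (star-pairs-suc n d) ⟩
  length (star 0 (map pair₀ F ++ shift S))        ≡⟨ length-filterᵇ-++ (memᵇ 0) (map pair₀ F) (shift S) ⟩
  length (star 0 (map pair₀ F)) + length (star 0 (shift S))
    ≡⟨ cong₂ _+_ (cong length (star-pair₀-zero F)) (cong length (star-zero-shift S)) ⟩
  length (map pair₀ F) + 0                        ≡⟨ +-identityʳ _ ⟩
  length (map pair₀ F)                            ≡⟨ length-map pair₀ F ⟩
  length F                                        ≤⟨ count-distinct d (upTo n) (upTo-distinct n) ⟩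
  1                                               ∎
  where
  open ≤-Reasoning
  F = filterᵇ (d ≡ᵇ_) (upTo n)
  S = star d (pairs n)
star-pair-size (suc n) (suc d) (suc e) d+1≢e+1 = begin
  length (star (suc e) (star (suc d) (pairs (suc n)))) ≡⟨ cong (length ∘ star (suc e)) (star-pairs-suc n d) ⟩
  length (star (suc e) (map pair₀ F ++ shift S))  ≡⟨ length-filterᵇ-++ (memᵇ (suc e)) (map pair₀ F) (shift S) ⟩
  length (star (suc e) (map pair₀ F)) + length (star (suc e) (shift S))
    ≡⟨ cong₂ _+_ (cong length (trans (star-pair₀-suc e F) (cong (map pair₀) noE)))
                 (trans (cong length (star-suc-shift e S)) (length-map (map suc) (star e S))) ⟩
  length (star e S)                               ≤⟨ star-pair-size n d e d≢e ⟩
  1                                               ∎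
  where
  open ≤-Reasoning
  F = filterᵇ (d ≡ᵇ_) (upTo n)
  S = star d (pairs n)
  d≢e = d+1≢e+1 ∘ cong suc
  -- every j ∈ F equals d, which differs from e
  noE : filterᵇ (e ≡ᵇ_) F ≡ []
  noE = filterᵇ-none _ F (All.map (λ d≡j → ≢⇒≡ᵇ-false (λ e≡j → d≢e (trans (≡ᵇ-true⇒≡ d≡j) (sym e≡j))))
                                  (filterᵇ-satisfies (d ≡ᵇ_) (upTo n)))

member-of-pair : (x i j : ℕ) → memᵇ x (i ∷ j ∷ []) ≡ true → x ≡ i ⊎ x ≡ j
member-of-pair x i j x∈ij with x ≡ᵇ i in x≡i
... | true = inj₁ (≡ᵇ-true⇒≡ x≡i)
... | false with x ≡ᵇ j in x≡j
...   | true = inj₂ (≡ᵇ-true⇒≡ x≡j)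
member-of-pair x i j () | false | false

pigeonhole : {d e f i j : ℕ} → d ≢ e → e ≢ f → d ≢ f → d ≡ i ⊎ d ≡ j → e ≡ i ⊎ e ≡ j → f ≡ i ⊎ f ≡ j → ⊥
pigeonhole d≢e e≢f d≢f (inj₁ refl) (inj₁ refl) _           = d≢e refl
pigeonhole d≢e e≢f d≢f (inj₂ refl) (inj₂ refl) _           = d≢e refl
pigeonhole d≢e e≢f d≢f (inj₁ refl) (inj₂ refl) (inj₁ refl) = d≢f refl
pigeonhole d≢e e≢f d≢f (inj₁ refl) (inj₂ refl) (inj₂ refl) = e≢f refl
pigeonhole d≢e e≢f d≢f (inj₂ refl) (inj₁ refl) (inj₁ refl) = e≢f refl
pigeonhole d≢e e≢f d≢f (inj₂ refl) (inj₁ refl) (inj₂ refl) = d≢f refl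

star-triple-empty : {d e f : ℕ} → d ≢ e → e ≢ f → d ≢ f → (L : List IndexSet) → All IsPair L →
  star f (star e (star d L)) ≡ []
star-triple-empty d≢e e≢f d≢f [] [] = refl
star-triple-empty {d} {e} {f} d≢e e≢f d≢f (v ∷ L) ((i , j , _ , refl) ∷ areP) with memᵇ d v in d∈v
... | false = star-triple-empty d≢e e≢f d≢f L areP
... | true with memᵇ e v in e∈v
...   | false = star-triple-empty d≢e e≢f d≢f L areP
...   | true with memᵇ f v in f∈v
...     | false = star-triple-empty d≢e e≢f d≢f L areP
...     | true = ⊥-elim (pigeonhole d≢e e≢f d≢f (member-of-pair d i j d∈v) (member-of-pair e i j e∈v)
                                                    (member-of-pair f i j f∈v))

-- Pairs through 0 with second points D, followed by the shifted star of d ∉ D: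
-- two cliques whose cross edges form a partial matching, because the neighbours of
-- {0, e+1} in the shifted star are the shifts of the pair {d, e}.
cliques-fan : (m n d : ℕ) (D : List ℕ) → d < n → AllPairs _≢_ D → All (d ≢_) D →
  cliques (3 + m) (map pair₀ D ++ shift (star d (pairs n))) ≡ length D C (3 + m) + (n ∸ 1) C (3 + m)
cliques-fan m n d D d<n distinct d∉D = begin
  cliques (3 + m) (map pair₀ D ++ shift S)
    ≡⟨ cliques-matching m (map pair₀ D) (shift S) (pairwiseAdj-pair₀ D distinct)
         (trans (pairwiseAdj-shift S) (star-clique n d)) fewNeighbours noCommonNeighbour ⟩
  length (map pair₀ D) C (3 + m) + length (shift S) C (3 + m)
    ≡⟨ cong₂ (λ a b → a C (3 + m) + b C (3 + m)) (length-map pair₀ D)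
             (trans (length-map (map suc) S) (star-size n d d<n)) ⟩
  length D C (3 + m) + (n ∸ 1) C (3 + m) ∎
  where
  open ≡-Reasoning
  S = star d (pairs n)
  S-pairs = star-are-pairs d (pairs n) (pairs-are-pairs n)
  neighbours : (e : ℕ) → filterᵇ (adjacentᵇ (pair₀ e)) (shift S) ≡ shift (star e S)
  neighbours e = neighbours-pair₀-shift e S S-pairs
  fewNeighbours : All (λ x → length (filterᵇ (adjacentᵇ x) (shift S)) ≤ 1) (map pair₀ D)
  fewNeighbours = All-map⁺ (All.map (λ {e} d≢e →
    subst (_≤ 1) (sym (trans (cong length (neighbours e)) (length-map (map suc) (star e S))))
          (star-pair-size n d e d≢e)) d∉D)
  noCommonNeighbour : AllPairs (λ x x′ → filterᵇ (adjacentᵇ x′) (filterᵇ (adjacentᵇ x) (shift S)) ≡ [])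
                               (map pair₀ D)
  noCommonNeighbour = AllPairs-map⁺ (allPairs-combine (λ {e} {f} d≢e d≢f e≢f → begin
    filterᵇ (adjacentᵇ (pair₀ f)) (filterᵇ (adjacentᵇ (pair₀ e)) (shift S))
      ≡⟨ cong (filterᵇ (adjacentᵇ (pair₀ f))) (neighbours e) ⟩
    filterᵇ (adjacentᵇ (pair₀ f)) (shift (star e S))
      ≡⟨ neighbours-pair₀-shift f (star e S) (star-are-pairs e S S-pairs) ⟩
    shift (star f (star e S))
      ≡⟨ cong shift (star-triple-empty d≢e e≢f d≢f (pairs n) (pairs-are-pairs n)) ⟩
    [] ∎) d∉D distinct)

-- Removing the pairs {0, d+1}, d ∈ D, one at a time: the cliques through {0, d+1} extend
-- cliques among the remaining pairs through 0 or inside its shifted star ('cliques-fan').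
cliques-layer : (m n : ℕ) (D : List ℕ) → AllPairs _≢_ D → All (_< n) D →
  cliques (4 + m) (map pair₀ D ++ shift (pairs n))
    ≡ length D C (4 + m) + length D * ((n ∸ 1) C (3 + m)) + cliques (4 + m) (pairs n)
cliques-layer m n [] [] [] = cliques-shift (4 + m) (pairs n)
cliques-layer m n (d ∷ D) (d∉D ∷ distinct) (d<n ∷ D<n) = begin
  cliques (4 + m) (pair₀ d ∷ map pair₀ D ++ shift (pairs n))
    ≡⟨ cliques-cons (3 + m) (pair₀ d) (map pair₀ D ++ shift (pairs n)) ⟩
  cliques (3 + m) (filterᵇ (adjacentᵇ (pair₀ d)) (map pair₀ D ++ shift (pairs n)))
    + cliques (4 + m) (map pair₀ D ++ shift (pairs n))
    ≡⟨ cong₂ _+_ (cong (cliques (3 + m)) (neighbours-in-layer d D (pairs n) d∉D (pairs-are-pairs n)))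
                 (cliques-layer m n D distinct D<n) ⟩
  cliques (3 + m) (map pair₀ D ++ shift (star d (pairs n))) + (length D C (4 + m) + length D * c + rest)
    ≡⟨ cong (_+ (length D C (4 + m) + length D * c + rest)) (cliques-fan m n d D d<n distinct d∉D) ⟩
  (length D C (3 + m) + c) + (length D C (4 + m) + length D * c + rest)
    ≡⟨ regroup (length D C (3 + m)) (length D C (4 + m)) c (length D * c) rest ⟩
  (length D C (3 + m) + length D C (4 + m)) + (c + length D * c) + rest
    ≡⟨ cong (λ z → z + (c + length D * c) + rest) (nCk+nC[k+1]≡[n+1]C[k+1] (length D) (3 + m)) ⟩
  suc (length D) C (4 + m) + suc (length D) * c + rest ∎
  where
  open ≡-Reasoning
  c = (n ∸ 1) C (3 + m)
  rest = cliques (4 + m) (pairs n)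
  regroup : (a a′ b b′ r : ℕ) → (a + b) + (a′ + b′ + r) ≡ (a + a′) + (b + b′) + r
  regroup = solve 5 (λ a a′ b b′ r → (a :+ b) :+ (a′ :+ b′ :+ r) := (a :+ a′) :+ (b :+ b′) :+ r) refl
    where open +-*-Solver

cliques-pairs : (m n : ℕ) → cliques (4 + m) (pairs n) ≡ n * ((n ∸ 1) C (4 + m))
cliques-pairs m zero = refl
cliques-pairs m (suc n) = begin
  cliques (4 + m) (pairs (suc n))                            ≡⟨ cong (cliques (4 + m)) (pairs-suc n) ⟩
  cliques (4 + m) (map pair₀ (upTo n) ++ shift (pairs n))    ≡⟨ cliques-layer m n (upTo n) (upTo-distinct n) (all-upTo n) ⟩
  length (upTo n) C (4 + m) + length (upTo n) * c + cliques (4 + m) (pairs n)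
    ≡⟨ cong₂ _+_ (cong (λ l → l C (4 + m) + l * c) (length-upTo n)) (cliques-pairs m n) ⟩
  n C (4 + m) + n * c + n * ((n ∸ 1) C (4 + m))              ≡⟨ +-assoc (n C (4 + m)) (n * c) _ ⟩
  n C (4 + m) + (n * c + n * ((n ∸ 1) C (4 + m)))            ≡⟨ cong (n C (4 + m) +_) (pascal-times n) ⟩
  suc n * (n C (4 + m))                                      ∎
  where
  open ≡-Reasoning
  c = (n ∸ 1) C (3 + m)
  pascal-times : (n : ℕ) → n * ((n ∸ 1) C (3 + m)) + n * ((n ∸ 1) C (4 + m)) ≡ n * (n C (4 + m))
  pascal-times zero = refl
  pascal-times (suc l) = trans (sym (*-distribˡ-+ (suc l) (l C (3 + m)) (l C (4 + m))))
                               (cong (suc l *_) (nCk+nC[k+1]≡[n+1]C[k+1] l (3 + m)))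

absorption-step : (m : ℕ) → (∀ j → suc j * (m C suc j) ≡ m * ((m ∸ 1) C j)) →
  (k : ℕ) → k * (m C k) + m * ((m ∸ 1) C k) ≡ m * (m C k)
absorption-step m _ zero = refl
absorption-step zero _ (suc j) = trans (+-identityʳ (j * 0)) (*-zeroʳ j)
absorption-step (suc l) absorption-l (suc j) = begin
  suc j * (suc l C suc j) + suc l * (l C suc j)  ≡⟨ cong (_+ suc l * (l C suc j)) (absorption-l j) ⟩
  suc l * (l C j) + suc l * (l C suc j)          ≡⟨ *-distribˡ-+ (suc l) (l C j) (l C suc j) ⟨
  suc l * (l C j + l C suc j)                    ≡⟨ cong (suc l *_) (nCk+nC[k+1]≡[n+1]C[k+1] l j) ⟩
  suc l * (suc l C suc j)                        ∎
  where open ≡-Reasoning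

absorption-suc : (n k : ℕ) → suc k * (n C suc k) ≡ n * ((n ∸ 1) C k)
absorption-suc zero k = *-zeroʳ (suc k)
absorption-suc (suc m) k = begin
  suc k * (suc m C suc k)                      ≡⟨ cong (suc k *_) (nCk+nC[k+1]≡[n+1]C[k+1] m k) ⟨
  suc k * (m C k + m C suc k)                  ≡⟨ *-distribˡ-+ (suc k) (m C k) (m C suc k) ⟩
  suc k * (m C k) + suc k * (m C suc k)        ≡⟨ cong (suc k * (m C k) +_) (absorption-suc m k) ⟩
  (m C k + k * (m C k)) + m * ((m ∸ 1) C k)    ≡⟨ +-assoc (m C k) (k * (m C k)) _ ⟩
  m C k + (k * (m C k) + m * ((m ∸ 1) C k))    ≡⟨ cong (m C k +_) (absorption-step m (absorption-suc m) k) ⟩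
  m C k + m * (m C k)                          ∎
  where open ≡-Reasoning

absorption : (n k : ℕ) → (k + 1) * (n C (k + 1)) ≡ n * ((n ∸ 1) C k)
absorption n k rewrite +-comm k 1 = absorption-suc n k

position-value : ℕ → ℕ × ℕ
position-value i = i , suc i

pair-is-occurrence : (v : IndexSet) → IsPair v → orderIsoᵇ (map proj₂ (map position-value v)) pat12 ≡ true
pair-is-occurrence v (i , j , i<j , refl)
  rewrite dec-true (i <? j) i<j | dec-false (j <? i) (<⇒≯ i<j) = refl

occurrences-12-identity : (n : ℕ) → occurrences pat12 (idPerm n) ≡ pairs n
occurrences-12-identity n = begin
  map (map proj₁) (filterᵇ is12 (combinations 2 (zip (upTo (length (idPerm n))) (idPerm n))))
    ≡⟨ cong (λ l → map (map proj₁) (filterᵇ is12 (combinations 2 (zip (upTo l) (idPerm n)))))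
            (trans (length-map suc (upTo n)) (length-upTo n)) ⟩
  map (map proj₁) (filterᵇ is12 (combinations 2 (zip (upTo n) (map suc (upTo n)))))
    ≡⟨ cong (λ z → map (map proj₁) (filterᵇ is12 (combinations 2 z))) (zip-positions (upTo n)) ⟩
  map (map proj₁) (filterᵇ is12 (combinations 2 (map position-value (upTo n))))
    ≡⟨ cong (map (map proj₁) ∘ filterᵇ is12) (combinations-map position-value 2 (upTo n)) ⟩
  map (map proj₁) (filterᵇ is12 (map (map position-value) (pairs n)))
    ≡⟨ cong (map (map proj₁)) (filterᵇ-map is12 (map position-value) (pairs n)) ⟩
  map (map proj₁) (map (map position-value) (filterᵇ (is12 ∘ map position-value) (pairs n)))
    ≡⟨ cong (map (map proj₁) ∘ map (map position-value))
            (filterᵇ-all _ (pairs n) (All.map (λ {v} → pair-is-occurrence v) (pairs-are-pairs n))) ⟩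
  map (map proj₁) (map (map position-value) (pairs n))
    ≡⟨ map-∘ (pairs n) ⟨
  map (map proj₁ ∘ map position-value) (pairs n)
    ≡⟨ map-cong (λ v → trans (sym (map-∘ v)) (map-id v)) (pairs n) ⟩
  map (λ v → v) (pairs n)
    ≡⟨ map-id (pairs n) ⟩
  pairs n ∎
  where
  open ≡-Reasoning
  is12 : List (ℕ × ℕ) → Bool
  is12 s = orderIsoᵇ (map proj₂ s) pat12
  zip-positions : (xs : List ℕ) → zip xs (map suc xs) ≡ map position-value xs
  zip-positions [] = refl
  zip-positions (x ∷ xs) = cong (position-value x ∷_) (zip-positions xs)

proposition4p1 : (n k : ℕ) → 0 < n → 3 < k →
    (numCliques k pat12 (idPerm n) ≡ (k + 1) * (n C (k + 1)))
      × ((k + 1) * (n C (k + 1)) ≡ n * ((n ∸ 1) C k))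
proposition4p1 n k@(suc (suc (suc (suc m)))) _ (s≤s (s≤s (s≤s (s≤s _)))) = trans count (sym (absorption n k)) , absorption n k
  where
  count : numCliques k pat12 (idPerm n) ≡ n * ((n ∸ 1) C k)
  count = trans (cong (cliques k) (occurrences-12-identity n)) (cliques-pairs m n)
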